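{- Let $P$ be a finite set of constrained Horn clauses over a constraint theory $\mathbb{T}$, let $k\ge 0$, and let $\mathsf{Safe}$ be a sound oracle. If the procedure $\mathrm{SolvePartition}(P,k,\emptyset)$ returns $(\mathsf{safe},\cdot)$ then $P$ is safe, and if it returns $(\mathsf{unsafe},\cdot)$ then $P$ is unsafe.
   Context: A constrained Horn clause (CHC) is $p_0(\bar x_0) \leftarrow \phi, p_1(\bar x_1),\ldots,p_n(\bar x_n)$ with $\phi$ a conjunction of constraints in $\mathbb{T}$; the head may be $\mathtt{false}$. AND-trees: each node corresponds to a clause (variables suitably renamed), labelled by its head atom and constraint, with children labelled by the body atoms; the tree is feasible if the conjunction of its constraints is satisfiable. A set of CHCs is safe iff it has no feasible AND-tree rooted at $\mathtt{false}$ (or at any renamed version of $\mathtt{false}$), and unsafe otherwise. A syntactic interpretation is a set of constrained facts $p(\bar x)\leftarrow\phi$, one per predicate. Tree dimension: for $t=c(t_1,\ldots,t_n)$, $\mathit{dim}(t)=0$ if $n=0$; otherwise with $m=\max_i\mathit{dim}(t_i)$, $\mathit{dim}(t)=m$ if a unique $i$ attains $m$ and $m+1$ otherwise. $P_{\mathit{dim}}$: each predicate $p$ gets an extra final argument ($p'$); each clause $p(\bar x)\leftarrow\phi,p_1(\bar x_1),\ldots,p_n(\bar x_n)$ becomes $p'(\bar x,k)\leftarrow\phi,p_1'(\bar x_1,k_1),\ldots,p_n'(\bar x_n,k_n),\mathit{dim}([k_1,\ldots,k_n],k)$ where the constraint $\mathit{dim}$ says $k=0$ if $n=0$, else with $m=\max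 k_i$, $k=m$ if exactly one $k_i=m$ and $k=m+1$ otherwise. Partial evaluation of a set of clauses $Q$ w.r.t. finite sets of constrained facts $S_0\subseteq\Psi$: $\mathsf{pe\_step}_Q(S)=\{q_i(\bar x_i)\leftarrow(\phi\wedge\theta)|_{\bar x_i}\mid q(\bar x)\leftarrow\theta\in S,\ q(\bar x)\leftarrow\phi,q_1(\bar x_1),\ldots,q_n(\bar x_n)\in Q,\ \theta\wedge\phi\text{ sat},\ 1\le i\le n\}$ (where $\phi|_{\bar v}$ existentially quantifies all variables not in $\bar v$); $\mathsf{rep}_\Psi(q(\bar x)\leftarrow\theta)=q(\bar x)\leftarrow\bigwedge\{\psi\mid q(\bar x)\leftarrow\psi\in\Psi,\theta\models\psi\}$; $\mathsf{abstract}_\Psi(S)=\{\mathsf{rep}_\Psi(c)\mid c\in S\}$; $S^*=\mathsf{lfp}\,\lambda S.(S_0\cup\mathsf{abstract}_\Psi(\mathsf{pe\_step}_Q(S)))$; the output is the set of clauses $q^{v_0}(\bar x)\leftarrow\theta\wedge\phi,q_1^{v_1}(\bar x_1),\ldots,q_n^{v_n}(\bar x_n)$ for $q(\bar x)\leftarrow\theta\in S^*$ and $q(\bar x)\leftarrow\phi,q_1(\bar x_1),\ldots\in Q$ with $\theta\wedge\phi$ satisfiable, where $q^{v_0}$ is the renamed version of $q$ for $\mathsf{rep}_\Psi(q(\bar x)\leftarrow\theta)$ and $q_j^{v_j}$ the version of $q_j$ for $\mathsf{rep}_\Psi(q_j(\bar x_j)\leftarrow(\theta\wedge\phi)|_{\bar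 x_j})$. For a set of CHCs $Q$ (with its own predicates $p$), $Q^{\le k}$ is this partial evaluation of $Q_{\mathit{dim}}$ with $S_0=\{p'(\bar x,z)\leftarrow z\lhd k\mid \lhd\in\{=,\le\}\}$ and $\Psi=\{p'(\bar x,z)\leftarrow z\lhd d\mid 0\le d\le k,\lhd\in\{=,\le\}\}$ (over all predicates $p$ of $Q$); $Q^{>k}$ is the partial evaluation of $Q_{\mathit{dim}}$ with $S_0=\{p'(\bar x,z)\leftarrow z\ge k+1\}$ and $\Psi=\{p'(\bar x,z)\leftarrow z\ge d\mid 0\le d\le k+1\}$. Lifting: for an interpretation $S$ given by constrained facts over annotated (renamed) predicates $p^\triangle$, $S^{\uparrow}=\{p(\bar x)\leftarrow\bigvee_{(p^\triangle(\bar x)\leftarrow\phi)\in S}\phi\}$. Sound oracle: a procedure $\mathsf{Safe}$ that on a set of CHCs $Q$ returns $(\mathsf{safe},R)$ only if $Q$ is safe (with $R$ a syntactic model of $Q$), $(\mathsf{unsafe},R)$ only if $Q$ is unsafe (with $R$ a counterexample, i.e. a feasible AND-tree rooted at a version of $\mathtt{false}$), and otherwise $\mathsf{unknown}$. Procedure $\mathrm{SolvePartition}(Q,k,S)$: (1) $(\mathit{status},R)\gets\mathsf{Safe}(Q^{\le k})$; if $\mathit{status}=\mathsf{unsafe}$ return $(\mathsf{unsafe},R)$; if $\mathit{status}=\mathsf{unknown}$ return $\mathsf{unknown}$. (2) Otherwise $(\mathit{status},R')\gets\mathsf{Safe}(Q^{>k})$; if $\mathsf{unsafe}$ return $(\mathsf{unsafe},R')$;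 if $\mathsf{safe}$ return $(\mathsf{safe},(S\cup R\cup R')^{\uparrow})$. (3) Otherwise return $\mathrm{SolvePartition}(Q^{>k},k+1,S\cup R)$. -}

module Defs where

open import Level using (Lift; lift; lower)
open import Function using (_∘_)
open import Data.Nat using (ℕ; zero; suc; _≤_; _⊔_; _≡ᵇ_; _+_)
open import Data.Fin using (Fin; splitAt; toℕ) renaming (zero to fz; suc to fs)
open import Data.List using (List; []; _∷_; map; _∷ʳ_; length; lookup; tabulate; foldr)
open import Data.List.Relation.Unary.All using (All)
open import Data.Vec using (Vec) renaming (lookup to vlookup)
open import Data.Bool using (Bool; true; false; if_then_else_)
open import Data.Product using (Σ; _×_; _,_; proj₁; proj₂)
open import Data.Sum using (_⊎_; inj₁; inj₂)
open import Relation.Nullary using (¬_)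
open import Relation.Binary.PropositionalEquality using (_≡_)

maxL : List ℕ → ℕ
maxL = foldr _⊔_ 0

countEq : ℕ → List ℕ → ℕ
countEq m [] = 0
countEq m (x ∷ xs) = if x ≡ᵇ m then suc (countEq m xs) else countEq m xs

dimOf : List ℕ → ℕ
dimOf [] = 0
dimOf (x ∷ xs) =
  if countEq (maxL (x ∷ xs)) (x ∷ xs) ≡ᵇ 1
  then maxL (x ∷ xs) else suc (maxL (x ∷ xs))

-- Answers of the oracle / of SolvePartition (models/counterexamples omitted).
data Status : Set where
  safe unsafe unknown : Status

-- CHCs over a constraint theory whose value domain is D, which contains
-- the natural numbers via ι (needed for the dimension argument).

module CHC (D : Set) (ι : ℕ → D) where

  -- A clause  hd(hdArgs) ← φ, q1(xs1), ..., qn(xsn)  with its own (local)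
  -- variables Var; the constraint φ is given by its meaning on valuations.
  record Clause (Pred : Set) : Set₁ where
    constructor mkClause
    field
      Var    : Set
      hd     : Pred
      hdArgs : List Var
      body   : List (Pred × List Var)
      φ      : (Var → D) → Set

  open Clause public

  -- A set of CHCs: predicates, which predicates are (versions of) false,
  -- and an indexed family of clauses.
  record System : Set₂ where
    constructor mkSystem
    field
      Pred    : Set
      IsFalse : Pred → Set
      Idx     : Set₁
      cl      : Idx → Clause Pred

  open System public

  -- Feasible AND-trees rooted at atom q(ts): every node is a clause of the
  -- system (renamed apart: each node gets its own valuation), labelled by its
  -- head; children are labelled by the body atoms; the conjunction of all
  -- constraints is satisfied (by the node valuations, which agree on the
  -- arguments linking a body atom to the head of the corresponding child).
  data Tree (Q : System) : Pred Q → List D → Set₁ where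
    node : ∀ {q ts} (i : Idx Q) → hd (cl Q i) ≡ q →
           (σ : Var (cl Q i) → D) → map σ (hdArgs (cl Q i)) ≡ ts →
           φ (cl Q i) σ →
           All (λ a → Tree Q (proj₁ a) (map σ (proj₂ a))) (body (cl Q i)) →
           Tree Q q ts

  HasCounterexample : System → Set₁
  HasCounterexample Q = Σ (Pred Q) λ p → IsFalse Q p × Σ (List D) λ ts → Tree Q p ts

  SafeSys : System → Set₁
  SafeSys Q = ¬ HasCounterexample Q

  finSystem : {Pred : Set} → Pred → List (Clause Pred) → System
  finSystem {Pred} fls cs =
    mkSystem Pred (λ p → p ≡ fls) (Lift _ (Fin (length cs))) (λ i → lookup cs (lower i))

  dimCon : ∀ {V : Set} (n : ℕ) → (V ⊎ Fin (suc n) → D) → Set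
  dimCon n σ = Σ (Fin n → ℕ) λ f →
    (∀ i → σ (inj₂ (fs i)) ≡ ι (f i)) × σ (inj₂ fz) ≡ ι (dimOf (tabulate f))

  -- variable inj₂ fz is k, variable inj₂ (fs i) is k_i
  dimClause : ∀ {Pred : Set} → Clause Pred → Clause Pred
  dimClause c = mkClause
    (Var c ⊎ Fin (suc (length (body c))))
    (hd c)
    (map inj₁ (hdArgs c) ∷ʳ inj₂ fz)
    (tabulate λ i → proj₁ (lookup (body c) i) ,
                    (map inj₁ (proj₂ (lookup (body c) i)) ∷ʳ inj₂ (fs i)))
    (λ σ → φ c (σ ∘ inj₁) × dimCon (length (body c)) σ)

  dimSystem : System → System
  dimSystem Q = mkSystem (Pred Q) (IsFalse Q) (Idx Q) (dimClause ∘ cl Q)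

  EqLast LeLast GeLast : ℕ → List D → Set
  EqLast d ts = Σ (List D) λ ys → ts ≡ ys ∷ʳ ι d
  LeLast d ts = Σ (List D) λ ys → Σ ℕ λ n → (ts ≡ ys ∷ʳ ι n) × n ≤ d
  GeLast d ts = Σ (List D) λ ys → Σ ℕ λ n → (ts ≡ ys ∷ʳ ι n) × d ≤ n

  -- Partial evaluation of Q w.r.t. S0 (facts S0 j, for every predicate) and
  -- Ψ (facts Ψ i, i < N, for every predicate).  Constrained facts are given
  -- by the set of argument tuples they denote.

  module PEval (Q : System) (M : ℕ) (S0 : Fin M → List D → Set)
               (N : ℕ) (Ψ : Fin N → List D → Set) where

    -- a version (renaming) of a predicate = the subset of Ψ in rep_Ψ
    Version : Set
    Version = Vec Bool N

    ⟦_⟧v : Version → List D → Set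
    ⟦ v ⟧v ts = ∀ i → vlookup v i ≡ true → Ψ i ts

    Entails : (List D → Set) → (List D → Set) → Set
    Entails F G = ∀ ts → F ts → G ts

    IsRep : (List D → Set) → Version → Set
    IsRep F v = ∀ i → (vlookup v i ≡ true → Entails F (Ψ i)) ×
                      (Entails F (Ψ i) → vlookup v i ≡ true)

    -- facts of S*: initial ones, or abstracted ones
    data Code : Set where
      init : Fin M → Code
      abs  : Version → Code

    ⟦_⟧c : Code → List D → Set
    ⟦ init j ⟧c = S0 j
    ⟦ abs v ⟧c = ⟦ v ⟧v

    SatWith : Clause (Pred Q) → (List D → Set) → Set
    SatWith c F = Σ (Var c → D) λ σ → φ c σ × F (map σ (hdArgs c))

    Proj : (c : Clause (Pred Q)) → (List D → Set) → Fin (length (body c)) → List D → Set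
    Proj c F m ts = Σ (Var c → D) λ σ →
      φ c σ × F (map σ (hdArgs c)) × map σ (proj₂ (lookup (body c) m)) ≡ ts

    -- S* = lfp λS. S0 ∪ abstract_Ψ(pe_step_Q(S))
    data SStar : Pred Q → Code → Set₁ where
      start : ∀ q j → SStar q (init j)
      step  : ∀ {q c} → SStar q c → (i : Idx Q) → hd (cl Q i) ≡ q →
              SatWith (cl Q i) ⟦ c ⟧c →
              (m : Fin (length (body (cl Q i)))) → (v : Version) →
              IsRep (Proj (cl Q i) ⟦ c ⟧c m) v →
              SStar (proj₁ (lookup (body (cl Q i)) m)) (abs v)

    record PEIdx : Set₁ where
      field
        q    : Pred Q
        c    : Code
        mem  : SStar q c
        i    : Idx Q
        hd≡  : hd (cl Q i) ≡ q
        sat  : SatWith (cl Q i) ⟦ c ⟧c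
        v0   : Version
        rep0 : IsRep ⟦ c ⟧c v0
        vs   : Fin (length (body (cl Q i))) → Version
        reps : ∀ m → IsRep (Proj (cl Q i) ⟦ c ⟧c m) (vs m)

    peClause : PEIdx → Clause (Pred Q × Version)
    peClause x = mkClause
      (Var (cl Q i))
      (q , v0)
      (hdArgs (cl Q i))
      (tabulate λ m → (proj₁ (lookup (body (cl Q i)) m) , vs m) ,
                      proj₂ (lookup (body (cl Q i)) m))
      (λ σ → ⟦ c ⟧c (map σ (hdArgs (cl Q i))) × φ (cl Q i) σ)
      where open PEIdx x

    PE : System
    PE = mkSystem (Pred Q × Version) (λ p → IsFalse Q (proj₁ p)) PEIdx peClause

  S0≤ : ℕ → Fin 2 → List D → Set
  S0≤ k fz = EqLast k
  S0≤ k (fs _) = LeLast k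

  Ψ≤ : (k : ℕ) → Fin (suc k + suc k) → List D → Set
  Ψ≤ k i with splitAt (suc k) i
  ... | inj₁ d = EqLast (toℕ d)
  ... | inj₂ d = LeLast (toℕ d)

  Le : System → ℕ → System
  Le Q k = PEval.PE (dimSystem Q) 2 (S0≤ k) (suc k + suc k) (Ψ≤ k)

  Gt : System → ℕ → System
  Gt Q k = PEval.PE (dimSystem Q) 1 (λ _ → GeLast (suc k)) (suc (suc k)) (λ d → GeLast (toℕ d))

  SoundOracle : (System → Status) → Set₂
  SoundOracle O = ∀ Q → (O Q ≡ safe → SafeSys Q) × (O Q ≡ unsafe → HasCounterexample Q)

  -- SolvePartition O Q k r : the run of SolvePartition(Q,k,S) with oracle O
  -- terminates and returns status r (the S argument only affects the model).
  data SolvePartition (O : System → Status) : System → ℕ → Status → Set₂ where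
    unsafe₁  : ∀ {Q k} → O (Le Q k) ≡ unsafe → SolvePartition O Q k unsafe
    unknown₁ : ∀ {Q k} → O (Le Q k) ≡ unknown → SolvePartition O Q k unknown
    unsafe₂  : ∀ {Q k} → O (Le Q k) ≡ safe → O (Gt Q k) ≡ unsafe →
               SolvePartition O Q k unsafe
    safe₂    : ∀ {Q k} → O (Le Q k) ≡ safe → O (Gt Q k) ≡ safe →
               SolvePartition O Q k safe
    recurse  : ∀ {Q k r} → O (Le Q k) ≡ safe → O (Gt Q k) ≡ unknown →
               SolvePartition O (Gt Q k) (suc k) r → SolvePartition O Q k r

-- A run of SolvePartition answers only on the strength of oracle answers for
-- the two partial evaluations Q^{≤k} and Q^{>k} of Q_dim, recursing on Q^{>k}.
-- It therefore suffices to prove, for an arbitrary system Q and bound k: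
--   reflection: a counterexample of Q^{≤k} or of Q^{>k} yields one of Q,
--     since partial evaluation only renames predicates and strengthens
--     constraints, and Q_dim only adds an argument;
--   covering: a counterexample of Q yields one of Q^{≤k} or of Q^{>k}:
--     annotate its AND-tree with tree dimensions (a tree of Q_dim rooted at
--     dimension d) and, according as d ≤ k or d > k, rebuild it node by node
--     in the partial evaluation, each node taking the version rep_Ψ of the
--     fact of S* that reaches it.
-- Since rep_Ψ decides entailments θ ⊨ ψ it exists only classically; as safety
-- is a negation, covering is proved in the double-negation monad.
module Submission where

open import Defs
open import Function using (_∘_)
open import Level using (Level)
open import Data.Nat using (ℕ; zero; suc; _≤?_; _+_)
open import Data.Nat.Properties using (≰⇒>)
open import Data.Fin using (Fin; toℕ) renaming (zero to fz; suc to fs)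
open import Data.List using (List; []; _∷_; map; _∷ʳ_; length; lookup; tabulate)
open import Data.List.Properties using (map-++; map-∘; tabulate-lookup; ∷ʳ-injectiveˡ)
open import Data.List.Relation.Unary.All using (All; []; _∷_)
open import Data.List.Relation.Unary.All.Properties using (tabulate⁺; tabulate⁻)
open import Data.Vec using () renaming (tabulate to vtabulate)
open import Data.Vec.Properties using (lookup∘tabulate)
open import Data.Bool using (Bool; true; false)
open import Data.Product using (Σ; _×_; _,_; proj₁; proj₂)
open import Data.Sum using (_⊎_; inj₁; inj₂; [_,_])
open import Data.Empty using (⊥-elim)
open import Relation.Nullary using (yes; no)
open import Relation.Nullary.Negation.Core using (DoubleNegation)
open import Relation.Nullary.Decidable.Core using (¬¬-excluded-middle)
open import Relation.Binary.PropositionalEquality using (_≡_; refl; sym; trans; cong; subst)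

private variable
  a b c p q : Level
  A : Set a
  B : Set b
  C : Set c

pure¬¬ : A → DoubleNegation A
pure¬¬ x ¬x = ¬x x

_>>=¬¬_ : DoubleNegation A → (A → DoubleNegation B) → DoubleNegation B
(¬¬x >>=¬¬ f) ¬y = ¬¬x (λ x → f x ¬y)

infixl 1 _>>=¬¬_

¬¬-finite-choice : ∀ n {T : Fin n → Set a} →
                   (∀ m → DoubleNegation (T m)) → DoubleNegation (∀ m → T m)
¬¬-finite-choice zero    h = pure¬¬ (λ ())
¬¬-finite-choice (suc n) h =
  h fz >>=¬¬ λ t₀ → ¬¬-finite-choice n (h ∘ fs) >>=¬¬ λ ts →
  pure¬¬ λ { fz → t₀ ; (fs m) → ts m }

¬¬-truth-value : (E : Set a) →
                 DoubleNegation (Σ Bool λ b → (b ≡ true → E) × (E → b ≡ true))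
¬¬-truth-value E = ¬¬-excluded-middle {A = E} >>=¬¬ λ where
  (yes e) → pure¬¬ (true , (λ _ → e) , λ _ → refl)
  (no ¬e) → pure¬¬ (false , (λ ()) , λ e → ⊥-elim (¬e e))

map-extended : (τ : A ⊎ B → C) (xs : List A) (w : B) →
               map τ (map inj₁ xs ∷ʳ inj₂ w) ≡ map (τ ∘ inj₁) xs ∷ʳ τ (inj₂ w)
map-extended τ xs w =
  trans (map-++ τ (map inj₁ xs) (inj₂ w ∷ [])) (cong (_∷ʳ τ (inj₂ w)) (sym (map-∘ xs)))

All-lookup : {P : A → Set p} {xs : List A} →
             All P xs → (m : Fin (length xs)) → P (lookup xs m)
All-lookup {P = P} {xs} pxs = tabulate⁻ (subst (All P) (sym (tabulate-lookup xs)) pxs)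

All-reindex : {P : B → Set p} {Q : A → Set q} (xs : List A) (g : Fin (length xs) → B) →
              (∀ m → P (g m) → Q (lookup xs m)) → All P (tabulate g) → All Q xs
All-reindex {Q = Q} xs g f ps =
  subst (All Q) (tabulate-lookup xs) (tabulate⁺ λ m → f m (tabulate⁻ ps m))

module _ (D : Set) (ι : ℕ → D) where
  open CHC D ι

  module Dimension (Q : System) where

    -- Annotating every node with dimOf of its children's annotations (its
    -- tree dimension) turns an AND-tree of Q into one of Q_dim.
    annotate : ∀ {q ts} → Tree Q q ts → Σ ℕ λ d → Tree (dimSystem Q) q (ts ∷ʳ ι d)
    annotateAll : ∀ {V : Set} {σ : V → D} {xs} →
      All (λ a → Tree Q (proj₁ a) (map σ (proj₂ a))) xs →
      All (λ a → Σ ℕ λ d → Tree (dimSystem Q) (proj₁ a) (map σ (proj₂ a) ∷ʳ ι d)) xs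
    annotateAll []       = []
    annotateAll (t ∷ ts) = annotate t ∷ annotateAll ts

    annotate {ts = ts} (node i h σ args ph ch) =
      d , node i h σ′ headArgs (ph , dims , (λ _ → refl) , refl) (tabulate⁺ child)
      where
        cᵢ : Clause (Pred Q)
        cᵢ = cl Q i
        n : ℕ
        n = length (body cᵢ)
        annotated : All (λ a → Σ ℕ λ d → Tree (dimSystem Q) (proj₁ a) (map σ (proj₂ a) ∷ʳ ι d))
                        (body cᵢ)
        annotated = annotateAll ch
        dims : Fin n → ℕ
        dims m = proj₁ (All-lookup annotated m)
        d : ℕ
        d = dimOf (tabulate dims)
        σ′ : Var cᵢ ⊎ Fin (suc n) → D
        σ′ (inj₁ x)      = σ x
        σ′ (inj₂ fz)     = ι d
        σ′ (inj₂ (fs m)) = ι (dims m)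
        headArgs : map σ′ (map inj₁ (hdArgs cᵢ) ∷ʳ inj₂ fz) ≡ ts ∷ʳ ι d
        headArgs = trans (map-extended σ′ (hdArgs cᵢ) fz) (cong (_∷ʳ ι d) args)
        child : ∀ m → Tree (dimSystem Q) (proj₁ (lookup (body cᵢ) m))
                        (map σ′ (map inj₁ (proj₂ (lookup (body cᵢ) m)) ∷ʳ inj₂ (fs m)))
        child m = subst (Tree (dimSystem Q) _) (sym (map-extended σ′ _ (fs m)))
                        (proj₂ (All-lookup annotated m))

    Unannotated : Pred Q → List D → Set₁
    Unannotated q ts = Σ (List D) λ ys → Σ D λ z → (ts ≡ ys ∷ʳ z) × Tree Q q ys

    strip : ∀ {q ts} → Tree (dimSystem Q) q ts → Unannotated q ts
    stripAll : ∀ {V : Set} {σ : V → D} {xs} →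
      All (λ a → Tree (dimSystem Q) (proj₁ a) (map σ (proj₂ a))) xs →
      All (λ a → Unannotated (proj₁ a) (map σ (proj₂ a))) xs
    stripAll []       = []
    stripAll (t ∷ ts) = strip t ∷ stripAll ts

    strip (node i h σ args (ph , _) ch) =
      map (σ ∘ inj₁) (hdArgs cᵢ) , σ (inj₂ fz) , trans (sym args) (map-extended σ _ fz) ,
      node i h (σ ∘ inj₁) refl ph (All-reindex (body cᵢ) _ child (stripAll ch))
      where
        cᵢ : Clause (Pred Q)
        cᵢ = cl Q i
        child : ∀ m → Unannotated _ (map σ (map inj₁ (proj₂ (lookup (body cᵢ) m)) ∷ʳ inj₂ (fs m))) →
                Tree Q (proj₁ (lookup (body cᵢ) m)) (map (σ ∘ inj₁) (proj₂ (lookup (body cᵢ) m)))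
        child m (ys , _ , e , t) =
          subst (Tree Q _) (sym (∷ʳ-injectiveˡ _ ys (trans (sym (map-extended σ _ (fs m))) e))) t

    reflect : HasCounterexample (dimSystem Q) → HasCounterexample Q
    reflect (p , isF , _ , t) with strip t
    ... | ys , _ , _ , t′ = p , isF , ys , t′

  module PartialEvaluation (R : System) (M : ℕ) (S0 : Fin M → List D → Set)
                           (N : ℕ) (Ψ : Fin N → List D → Set) where
    open PEval R M S0 N Ψ

    -- Reflection: forgetting versions and the added constraints θ maps
    -- AND-trees of the partial evaluation to AND-trees of R.
    forget : ∀ {p ts} → Tree PE p ts → Tree R (proj₁ p) ts
    forgetAll : ∀ {V : Set} {σ : V → D} {xs} →
      All (λ a → Tree PE (proj₁ a) (map σ (proj₂ a))) xs →
      All (λ a → Tree R (proj₁ (proj₁ a)) (map σ (proj₂ a))) xs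
    forgetAll []       = []
    forgetAll (t ∷ ts) = forget t ∷ forgetAll ts

    forget (node x h σ args (_ , ph) ch) =
      node i (trans hd≡ (cong proj₁ h)) σ args ph
           (All-reindex (body (cl R i)) _ (λ _ t → t) (forgetAll ch))
      where open PEIdx x

    reflect : HasCounterexample PE → HasCounterexample R
    reflect ((p , _) , isF , ts , t) = p , isF , ts , forget t

    -- rep_Ψ(F) exists classically: decide each entailment F ⊨ Ψ i.
    rep-exists : (F : List D → Set) → DoubleNegation (Σ Version (IsRep F))
    rep-exists F =
      ¬¬-finite-choice N (λ i → ¬¬-truth-value (Entails F (Ψ i))) >>=¬¬ λ h →
      pure¬¬ (vtabulate (proj₁ ∘ h) , λ i →
        subst (λ b → (b ≡ true → Entails F (Ψ i)) × (Entails F (Ψ i) → b ≡ true))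
              (sym (lookup∘tabulate (proj₁ ∘ h) i)) (proj₂ (h i)))

    -- rep_Ψ is idempotent: an abstracted fact abs v has version v again.
    rep-idempotent : ∀ {F v} → IsRep F v → IsRep ⟦ v ⟧v v
    rep-idempotent rep i =
      (λ e ts w → w i e) ,
      λ ent → proj₂ (rep i) (λ ts Fts → ent ts (λ j e → proj₁ (rep j) e ts Fts))

    -- Invariant of the reconstruction: the atom q(ts) satisfies a fact of
    -- S* whose representative is the version v.
    Reached : Pred R → List D → Version → Set₁
    Reached q ts v = Σ Code λ c → SStar q c × ⟦ c ⟧c ts × IsRep ⟦ c ⟧c v

    -- An AND-tree of R rooted at a reached atom is (classically) an AND-tree
    -- of the partial evaluation: at each node choose the body versions as
    -- rep_Ψ of the projected constraints, then the children are reached too.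
    rebuild : ∀ {q ts v} → Reached q ts v → Tree R q ts → DoubleNegation (Tree PE (q , v) ts)
    rebuildAll : ∀ {V : Set} (σ : V → D) {xs : List (Pred R × List V)} →
      All (λ a → Tree R (proj₁ a) (map σ (proj₂ a))) xs →
      (w : Fin (length xs) → Version) →
      (∀ m → Reached (proj₁ (lookup xs m)) (map σ (proj₂ (lookup xs m))) (w m)) →
      ∀ m → DoubleNegation (Tree PE (proj₁ (lookup xs m) , w m) (map σ (proj₂ (lookup xs m))))
    rebuildAll σ (t ∷ _)  w r fz     = rebuild (r fz) t
    rebuildAll σ (_ ∷ ts) w r (fs m) = rebuildAll σ ts (w ∘ fs) (r ∘ fs) m

    rebuild {q} {v = v} (c , mem , cts , rep) (node i h σ args ph ch) =
      ¬¬-finite-choice _ (λ m → rep-exists (Proj cᵢ ⟦ c ⟧c m)) >>=¬¬ λ vr →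
      ¬¬-finite-choice _ (rebuildAll σ ch (proj₁ ∘ vr) (reached vr)) >>=¬¬ λ children →
      pure¬¬ (node (outClause vr) refl σ args (θ , ph) (tabulate⁺ children))
      where
        cᵢ : Clause (Pred R)
        cᵢ = cl R i
        Reps : Set
        Reps = ∀ m → Σ Version (IsRep (Proj cᵢ ⟦ c ⟧c m))
        θ : ⟦ c ⟧c (map σ (hdArgs cᵢ))
        θ = subst ⟦ c ⟧c (sym args) cts
        outClause : Reps → PEIdx
        outClause vr = record { q = q ; c = c ; mem = mem ; i = i ; hd≡ = h ;
                                sat = σ , ph , θ ; v0 = v ; rep0 = rep ;
                                vs = proj₁ ∘ vr ; reps = proj₂ ∘ vr }
        -- each body atom is reached by the fact pe_step derives for it
        reached : (vr : Reps) → ∀ m →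
          Reached (proj₁ (lookup (body cᵢ) m)) (map σ (proj₂ (lookup (body cᵢ) m))) (proj₁ (vr m))
        reached vr m =
          abs (proj₁ (vr m)) , step mem i h (σ , ph , θ) m (proj₁ (vr m)) (proj₂ (vr m)) ,
          (λ j e → proj₁ (proj₂ (vr m) j) e _ (σ , ph , θ , refl)) ,
          rep-idempotent {v = proj₁ (vr m)} (proj₂ (vr m))

    cover : ∀ {q ts} j → S0 j ts → Tree R q ts →
            DoubleNegation (Σ Version λ v → Tree PE (q , v) ts)
    cover {q} j s t =
      rep-exists (S0 j) >>=¬¬ λ where
        (v , rep) → rebuild (init j , start q j , s , rep) t >>=¬¬ λ t′ → pure¬¬ (v , t′)

  module Below (Q : System) (k : ℕ) =
    PartialEvaluation (dimSystem Q) 2 (S0≤ k) (suc k + suc k) (Ψ≤ k)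
  module Above (Q : System) (k : ℕ) =
    PartialEvaluation (dimSystem Q) 1 (λ _ → GeLast (suc k)) (suc (suc k)) (λ d → GeLast (toℕ d))

  le-reflect : ∀ Q k → HasCounterexample (Le Q k) → HasCounterexample Q
  le-reflect Q k = Dimension.reflect Q ∘ Below.reflect Q k

  gt-reflect : ∀ Q k → HasCounterexample (Gt Q k) → HasCounterexample Q
  gt-reflect Q k = Dimension.reflect Q ∘ Above.reflect Q k

  partition-cover : ∀ Q k → HasCounterexample Q →
                    DoubleNegation (HasCounterexample (Le Q k) ⊎ HasCounterexample (Gt Q k))
  partition-cover Q k (p , isF , ts , t) with Dimension.annotate Q t
  ... | d , t′ with d ≤? k
  ... | yes d≤k = Below.cover Q k (fs fz) (ts , d , refl , d≤k) t′ >>=¬¬ λ where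
                    (v , t″) → pure¬¬ (inj₁ ((p , v) , isF , _ , t″))
  ... | no d≰k  = Above.cover Q k fz (ts , d , refl , ≰⇒> d≰k) t′ >>=¬¬ λ where
                    (v , t″) → pure¬¬ (inj₂ ((p , v) , isF , _ , t″))

  partition-safe : ∀ Q k → SafeSys (Le Q k) → SafeSys (Gt Q k) → SafeSys Q
  partition-safe Q k safe≤ safe> cex = partition-cover Q k cex [ safe≤ , safe> ]

  module _ {O : System → Status} (sound : SoundOracle O) where

    safe-answer : ∀ {Q k} → SolvePartition O Q k safe → SafeSys Q
    safe-answer (safe₂ ok≤ ok>) =
      partition-safe _ _ (proj₁ (sound _) ok≤) (proj₁ (sound _) ok>)
    safe-answer (recurse ok≤ _ run) =
      partition-safe _ _ (proj₁ (sound _) ok≤) (safe-answer run)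

    unsafe-answer : ∀ {Q k} → SolvePartition O Q k unsafe → HasCounterexample Q
    unsafe-answer (unsafe₁ bad≤)    = le-reflect _ _ (proj₂ (sound _) bad≤)
    unsafe-answer (unsafe₂ _ bad>)  = gt-reflect _ _ (proj₂ (sound _) bad>)
    unsafe-answer (recurse _ _ run) = gt-reflect _ _ (unsafe-answer run)

proposition4 : (D : Set) (ι : ℕ → D) (Pred : Set) (fls : Pred)
               (P : List (CHC.Clause D ι Pred)) (k : ℕ)
               (O : CHC.System D ι → Status) → CHC.SoundOracle D ι O →
               (CHC.SolvePartition D ι O (CHC.finSystem D ι fls P) k safe →
                 CHC.SafeSys D ι (CHC.finSystem D ι fls P))
               × (CHC.SolvePartition D ι O (CHC.finSystem D ι fls P) k unsafe →
                 CHC.HasCounterexample D ι (CHC.finSystem D ι fls P))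
proposition4 D ι Pred fls P k O sound = safe-answer D ι sound , unsafe-answer D ι sound
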